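{- For $n>2$ let $\mathcal{I}_n$ be the instance of fixed order scheduling with deadlines with jobs $1,\dots,n$ (in this fixed order), where $(p_1,d_1)=(1,1)$, $(p_2,d_2)=(2,2)$, and for $j>2$, $p_j=p_{j-1}+p_{j-2}$ and $d_j=p_j+p_{j-1}-1$. Then the ratio $NF(\mathcal{I}_n)/OPT(\mathcal{I}_n)$ is unbounded as $n\to\infty$, i.e. the next-fit algorithm has unbounded approximation ratio on the family $(\mathcal{I}_n)_{n>2}$.
   Context: Fixed order scheduling with deadlines: there are $n$ jobs $1,\dots,n$, job $j$ having processing time $p_j\in\mathbb{N}$, $p_j>0$, and deadline $d_j\in\mathbb{N}$ with $d_j\ge p_j$. All jobs are released at time $0$, and there are sufficiently many identical machines. A schedule is a map $\tau:\{1,\dots,n\}\to\{1,\dots,n\}$ assigning jobs to machines; each machine processes its assigned jobs non-preemptively, without idle time, in increasing order of job index (the fixed order). The schedule is feasible if $\sum_{k\le j,\ \tau(k)=\tau(j)}p_k\le d_j$ for every job $j$. A machine is open if it receives at least one job; the objective is to minimize the number of open machines. $OPT(I)$ is the minimum number of open machines over feasible schedules of instance $I$. The next-fit algorithm (NF) considers jobs in the order $1,\dots,n$ and appends each job to the most recently opened machine if it would still meet its deadline there, and otherwise opens a new machine for it; $NF(I)$ is the number of machines it opens. -}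

module Defs where

open import Data.Nat using (ℕ; zero; suc; _+_; _∸_; _≤_; _<_; _≤ᵇ_; s≤s; z≤n)
open import Data.Nat.Properties using (≤-trans; ≤-refl; m≤m+n; +-∸-assoc; ≤-reflexive)
open import Relation.Binary.PropositionalEquality using (_≡_; refl; sym; trans; cong)
open import Data.Bool using (Bool; true; false; if_then_else_; _∧_)
open import Data.Fin using (Fin; toℕ; _≟_)
open import Data.Fin.Properties using (any?)
open import Data.List using (List; []; _∷_; map; allFin)
open import Data.Nat.ListAction using (sum)
open import Data.Product using (_×_; _,_; Σ; ∃)
open import Relation.Nullary.Decidable using (⌊_⌋)

-- An instance of fixed order scheduling with deadlines with n jobs.
-- Jobs 1,…,n of the paper are represented by Fin n (job j ↦ index j-1),
-- and the fixed order is the order of indices.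
record Instance : Set where
  field
    n  : ℕ
    p  : Fin n → ℕ
    d  : Fin n → ℕ
    p>0  : ∀ j → 0 < p j
    d≥p  : ∀ j → p j ≤ d j
open Instance public

Schedule : Instance → Set
Schedule I = Fin (n I) → Fin (n I)

completion : (I : Instance) → Schedule I → Fin (n I) → ℕ
completion I τ j =
  sum (map (λ k → if (toℕ k ≤ᵇ toℕ j) ∧ ⌊ τ k ≟ τ j ⌋ then p I k else 0)
           (allFin (n I)))

Feasible : (I : Instance) → Schedule I → Set
Feasible I τ = ∀ j → completion I τ j ≤ d I j

openMachines : (I : Instance) → Schedule I → ℕ
openMachines I τ =
  sum (map (λ m → if ⌊ any? (λ j → τ j ≟ m) ⌋ then 1 else 0) (allFin (n I)))

IsOPT : Instance → ℕ → Set
IsOPT I m =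
  (Σ (Schedule I) λ τ → Feasible I τ × openMachines I τ ≡ m)
  × (∀ τ → Feasible I τ → m ≤ openMachines I τ)

-- Next-fit on a list of jobs (p , d) in the fixed order.
-- nfGo c l js : c machines opened so far, l = current load of the most
-- recently opened machine.
nfGo : ℕ → ℕ → List (ℕ × ℕ) → ℕ
nfGo c l [] = c
nfGo c l ((pj , dj) ∷ js) =
  if l + pj ≤ᵇ dj then nfGo c (l + pj) js else nfGo (suc c) pj js

nfList : List (ℕ × ℕ) → ℕ
nfList [] = 0
nfList ((pj , dj) ∷ js) = nfGo 1 pj js

NF : Instance → ℕ
NF I = nfList (map (λ j → (p I j , d I j)) (allFin (n I)))

-- The family I_n.  fibP k = p_{k+1}, fibD k = d_{k+1}.
fibP : ℕ → ℕ
fibP 0 = 1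
fibP 1 = 2
fibP (suc (suc k)) = fibP (suc k) + fibP k

fibD : ℕ → ℕ
fibD 0 = 1
fibD 1 = 2
fibD (suc (suc k)) = fibP (suc (suc k)) + fibP (suc k) ∸ 1

fibP>0 : ∀ k → 0 < fibP k
fibP>0 0 = s≤s z≤n
fibP>0 1 = s≤s z≤n
fibP>0 (suc (suc k)) = ≤-trans (fibP>0 (suc k)) (m≤m+n (fibP (suc k)) (fibP k))

fibD≥fibP : ∀ k → fibP k ≤ fibD k
fibD≥fibP 0 = ≤-refl
fibD≥fibP 1 = ≤-refl
fibD≥fibP (suc (suc k)) =
  ≤-trans (m≤m+n (fibP (suc (suc k))) (fibP (suc k) ∸ 1))
          (≤-reflexive (sym (+-∸-assoc (fibP (suc (suc k))) (fibP>0 (suc k)))))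

𝓘 : ℕ → Instance
𝓘 m = record
  { n = m
  ; p = λ j → fibP (toℕ j)
  ; d = λ j → fibD (toℕ j)
  ; p>0 = λ j → fibP>0 (toℕ j)
  ; d≥p = λ j → fibD≥fibP (toℕ j)
  }

-- Putting the jobs of odd index on one machine and those of even index on
-- another is feasible: since d_j = p_j + d_{j-2}, the deadline d_j is exactly
-- p_j + p_{j-2} + p_{j-4} + ⋯, the completion time of job j there.  Jobs 1 and
-- 2 cannot share a machine, so OPT(I_n) = 2.  Next-fit never fits job j+1
-- behind job j, because p_j + p_{j+1} = p_{j+2} > d_{j+1}, so NF(I_n) = n.
module Submission where

open import Defs
open import Data.Bool using (Bool; true; false; if_then_else_; _∧_)
open import Data.Fin using (Fin; zero; suc; toℕ; _≟_)
open import Data.Fin.Properties using (any?; toℕ<n)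
open import Data.List using (_∷_; [_]; _++_; map; allFin; tabulate; applyUpTo)
open import Data.List.Properties using (map-tabulate; applyUpTo-∷ʳ)
open import Data.Nat using (ℕ; zero; suc; _+_; _*_; _∸_; _≤_; _<_; _≤′_; ≤′-refl; ≤′-step; _≤ᵇ_; _≤?_; s≤s; z≤n)
open import Data.Nat.ListAction using (sum)
open import Data.Nat.ListAction.Properties using (sum-++)
open import Data.Nat.Properties
  using (≤-refl; ≤-trans; ≤-reflexive; <⇒≱; ≤⇒≤′; ≤′⇒≤; m≤m+n; m≤n+m; m<n+m; +-identityʳ; +-suc; +-comm; +-∸-assoc; +-monoʳ-≤; ∸-monoʳ-<; module ≤-Reasoning)
open import Data.Product using (Σ; _×_; _,_)
open import Function using (_∘_)
open import Relation.Binary.PropositionalEquality using (_≡_; _≢_; refl; sym; trans; cong; cong₂; subst; module ≡-Reasoning)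
open import Relation.Nullary using (Dec; yes; no; ¬_; contradiction)
open import Relation.Nullary.Decidable using (⌊_⌋; dec-true; dec-false)

private
  variable
    A : Set

if-⌊⌋-yes : ∀ {P : Set} (p? : Dec P) {x y : A} → P → (if ⌊ p? ⌋ then x else y) ≡ x
if-⌊⌋-yes (yes _) _ = refl
if-⌊⌋-yes (no ¬p) p = contradiction p ¬p

if-⌊⌋-no : ∀ {P : Set} (p? : Dec P) {x y : A} → ¬ P → (if ⌊ p? ⌋ then x else y) ≡ y
if-⌊⌋-no (yes p) ¬p = contradiction p ¬p
if-⌊⌋-no (no _) _ = refl

≤ᵇ-true : ∀ {i t} → i ≤ t → (i ≤ᵇ t) ≡ true
≤ᵇ-true {i} {t} = dec-true (i ≤? t)

≤ᵇ-false : ∀ {i t} → t < i → (i ≤ᵇ t) ≡ false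
≤ᵇ-false {i} {t} t<i = dec-false (i ≤? t) (<⇒≱ t<i)

tabulate-toℕ : ∀ n (g : ℕ → A) → tabulate {n = n} (g ∘ toℕ) ≡ applyUpTo g n
tabulate-toℕ zero    g = refl
tabulate-toℕ (suc n) g = cong (g 0 ∷_) (tabulate-toℕ n (g ∘ suc))

map-allFin-toℕ : ∀ n (g : ℕ → A) → map (g ∘ toℕ) (allFin n) ≡ applyUpTo g n
map-allFin-toℕ n g = trans (map-tabulate (λ i → i) (g ∘ toℕ)) (tabulate-toℕ n g)

applyUpTo-cong< : ∀ n {f g : ℕ → A} → (∀ {i} → i < n → f i ≡ g i) → applyUpTo f n ≡ applyUpTo g n
applyUpTo-cong< zero    f≡g = refl
applyUpTo-cong< (suc n) f≡g = cong₂ _∷_ (f≡g (s≤s z≤n)) (applyUpTo-cong< n (f≡g ∘ s≤s))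

sum-applyUpTo-suc : ∀ (f : ℕ → ℕ) n → sum (applyUpTo f (suc n)) ≡ sum (applyUpTo f n) + f n
sum-applyUpTo-suc f n = begin
  sum (applyUpTo f (suc n))          ≡⟨ cong sum (sym (applyUpTo-∷ʳ f n)) ⟩
  sum (applyUpTo f n ++ [ f n ])     ≡⟨ sum-++ (applyUpTo f n) [ f n ] ⟩
  sum (applyUpTo f n) + (f n + 0)    ≡⟨ cong (sum (applyUpTo f n) +_) (+-identityʳ (f n)) ⟩
  sum (applyUpTo f n) + f n          ∎
  where open ≡-Reasoning

sum-applyUpTo-vanishing : ∀ {f : ℕ → ℕ} {m n} → (∀ {i} → m ≤ i → f i ≡ 0) → m ≤′ n →
                          sum (applyUpTo f n) ≡ sum (applyUpTo f m)
sum-applyUpTo-vanishing f≡0 ≤′-refl = refl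
sum-applyUpTo-vanishing {f} {m} {suc n} f≡0 (≤′-step m≤′n) = begin
  sum (applyUpTo f (suc n))   ≡⟨ sum-applyUpTo-suc f n ⟩
  sum (applyUpTo f n) + f n   ≡⟨ cong₂ _+_ (sum-applyUpTo-vanishing f≡0 m≤′n) (f≡0 (≤′⇒≤ m≤′n)) ⟩
  sum (applyUpTo f m) + 0     ≡⟨ +-identityʳ _ ⟩
  sum (applyUpTo f m)         ∎
  where open ≡-Reasoning

sum-applyUpTo-prefix : ∀ {t n} (b : ℕ → Bool) (g : ℕ → ℕ) → t < n →
  sum (applyUpTo (λ i → if (i ≤ᵇ t) ∧ b i then g i else 0) n)
    ≡ sum (applyUpTo (λ i → if b i then g i else 0) (suc t))
sum-applyUpTo-prefix {t} {n} b g t<n = begin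
  sum (applyUpTo truncated n)        ≡⟨ sum-applyUpTo-vanishing beyond (≤⇒≤′ t<n) ⟩
  sum (applyUpTo truncated (suc t))  ≡⟨ cong sum (applyUpTo-cong< (suc t) within) ⟩
  sum (applyUpTo selected (suc t))   ∎
  where
  open ≡-Reasoning
  truncated selected : ℕ → ℕ
  truncated i = if (i ≤ᵇ t) ∧ b i then g i else 0
  selected i = if b i then g i else 0
  beyond : ∀ {i} → suc t ≤ i → truncated i ≡ 0
  beyond t<i rewrite ≤ᵇ-false t<i = refl
  within : ∀ {i} → i < suc t → truncated i ≡ selected i
  within (s≤s i≤t) rewrite ≤ᵇ-true i≤t = refl

fibD≡fibP-suc∸1 : ∀ t → fibD t ≡ fibP (suc t) ∸ 1
fibD≡fibP-suc∸1 0 = refl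
fibD≡fibP-suc∸1 1 = refl
fibD≡fibP-suc∸1 (suc (suc t)) = refl

fibD-suc-suc : ∀ t → fibD (suc (suc t)) ≡ fibP (suc (suc t)) + fibD t
fibD-suc-suc t = begin
  fibP (suc (suc t)) + fibP (suc t) ∸ 1    ≡⟨ +-∸-assoc (fibP (suc (suc t))) (fibP>0 (suc t)) ⟩
  fibP (suc (suc t)) + (fibP (suc t) ∸ 1)  ≡⟨ cong (fibP (suc (suc t)) +_) (sym (fibD≡fibP-suc∸1 t)) ⟩
  fibP (suc (suc t)) + fibD t              ∎
  where open ≡-Reasoning

fibD<fibP-suc : ∀ t → fibD t < fibP (suc t)
fibD<fibP-suc t rewrite fibD≡fibP-suc∸1 t = ∸-monoʳ-< {o = 0} (s≤s z≤n) (fibP>0 (suc t))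

alternate : ∀ {r} → ℕ → Fin (suc (suc r))
alternate 0 = zero
alternate 1 = suc zero
alternate (suc (suc t)) = alternate t

alternate-suc≢ : ∀ {r} t → alternate {r} (suc t) ≢ alternate t
alternate-suc≢ 0 ()
alternate-suc≢ 1 ()
alternate-suc≢ (suc (suc t)) = alternate-suc≢ t

alternate≢suc-suc : ∀ {r} t (k : Fin r) → alternate t ≢ suc (suc k)
alternate≢suc-suc 0 k ()
alternate≢suc-suc 1 k ()
alternate≢suc-suc (suc (suc t)) = alternate≢suc-suc t

sum-fibP-sameParity : ∀ {r} t →
  sum (applyUpTo (λ i → if ⌊ alternate {r} i ≟ alternate t ⌋ then fibP i else 0) (suc t)) ≡ fibD t
sum-fibP-sameParity 0 = refl
sum-fibP-sameParity 1 = refl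
sum-fibP-sameParity {r} (suc (suc t)) = begin
  sum (applyUpTo parityTerm (suc (suc (suc t))))
    ≡⟨ sum-applyUpTo-suc parityTerm (suc (suc t)) ⟩
  sum (applyUpTo parityTerm (suc (suc t))) + parityTerm (suc (suc t))
    ≡⟨ cong₂ _+_ (sum-applyUpTo-suc parityTerm (suc t)) (if-⌊⌋-yes (alternate t ≟ alternate t) refl) ⟩
  sum (applyUpTo parityTerm (suc t)) + parityTerm (suc t) + fibP (suc (suc t))
    ≡⟨ cong (λ x → x + fibP (suc (suc t)))
            (cong₂ _+_ (sum-fibP-sameParity t) (if-⌊⌋-no (alternate (suc t) ≟ alternate t) (alternate-suc≢ t))) ⟩
  fibD t + 0 + fibP (suc (suc t))
    ≡⟨ cong (_+ fibP (suc (suc t))) (+-identityʳ (fibD t)) ⟩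
  fibD t + fibP (suc (suc t))
    ≡⟨ +-comm (fibD t) _ ⟩
  fibP (suc (suc t)) + fibD t
    ≡⟨ sym (fibD-suc-suc t) ⟩
  fibD (suc (suc t)) ∎
  where
  open ≡-Reasoning
  parityTerm : ℕ → ℕ
  parityTerm i = if ⌊ alternate {r} i ≟ alternate t ⌋ then fibP i else 0

alternating : ∀ r → Schedule (𝓘 (suc (suc r)))
alternating r j = alternate (toℕ j)

alternating-feasible : ∀ r → Feasible (𝓘 (suc (suc r))) (alternating r)
alternating-feasible r j = ≤-reflexive (begin
  completion (𝓘 (suc (suc r))) (alternating r) j
    ≡⟨ cong sum (map-allFin-toℕ (suc (suc r)) (λ i → if (i ≤ᵇ t) ∧ sameMachine i then fibP i else 0)) ⟩
  sum (applyUpTo (λ i → if (i ≤ᵇ t) ∧ sameMachine i then fibP i else 0) (suc (suc r)))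
    ≡⟨ sum-applyUpTo-prefix sameMachine fibP (toℕ<n j) ⟩
  sum (applyUpTo (λ i → if sameMachine i then fibP i else 0) (suc t))
    ≡⟨ sum-fibP-sameParity t ⟩
  fibD t ∎)
  where
  open ≡-Reasoning
  t = toℕ j
  sameMachine : ℕ → Bool
  sameMachine i = ⌊ alternate {r} i ≟ alternate t ⌋

≤sum-tabulate : ∀ {n} (f : Fin n → ℕ) a → f a ≤ sum (tabulate f)
≤sum-tabulate f zero    = m≤m+n _ _
≤sum-tabulate f (suc a) = ≤-trans (≤sum-tabulate (f ∘ suc) a) (m≤n+m _ (f zero))

pair≤sum-tabulate : ∀ {n} (f : Fin n → ℕ) {a b} → a ≢ b → f a + f b ≤ sum (tabulate f)
pair≤sum-tabulate f {zero}  {zero}  a≢b = contradiction refl a≢b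
pair≤sum-tabulate f {zero}  {suc b} a≢b = +-monoʳ-≤ (f zero) (≤sum-tabulate (f ∘ suc) b)
pair≤sum-tabulate f {suc a} {zero}  a≢b =
  subst (_≤ sum (tabulate f)) (+-comm (f zero) (f (suc a))) (+-monoʳ-≤ (f zero) (≤sum-tabulate (f ∘ suc) a))
pair≤sum-tabulate f {suc a} {suc b} a≢b =
  ≤-trans (pair≤sum-tabulate (f ∘ suc) (a≢b ∘ cong suc)) (m≤n+m _ (f zero))

sum-tabulate-0 : ∀ {n} (f : Fin n → ℕ) → (∀ i → f i ≡ 0) → sum (tabulate f) ≡ 0
sum-tabulate-0 {zero}  f f≡0 = refl
sum-tabulate-0 {suc n} f f≡0 = cong₂ _+_ (f≡0 zero) (sum-tabulate-0 (f ∘ suc) (f≡0 ∘ suc))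

machineOpen : ∀ {m} → (Fin m → Fin m) → Fin m → ℕ
machineOpen τ k = if ⌊ any? (λ j → τ j ≟ k) ⌋ then 1 else 0

openMachines≡sum-tabulate : ∀ I (τ : Schedule I) → openMachines I τ ≡ sum (tabulate (machineOpen τ))
openMachines≡sum-tabulate I τ = cong sum (map-tabulate (λ k → k) (machineOpen τ))

machineOpen-used : ∀ {m} (τ : Fin m → Fin m) j → machineOpen τ (τ j) ≡ 1
machineOpen-used τ j = if-⌊⌋-yes (any? (λ i → τ i ≟ τ j)) (j , refl)

2≤openMachines : ∀ I (τ : Schedule I) {a b} → τ a ≢ τ b → 2 ≤ openMachines I τ
2≤openMachines I τ {a} {b} τa≢τb = begin
  2                                          ≡⟨ sym (cong₂ _+_ (machineOpen-used τ a) (machineOpen-used τ b)) ⟩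
  machineOpen τ (τ a) + machineOpen τ (τ b)  ≤⟨ pair≤sum-tabulate (machineOpen τ) τa≢τb ⟩
  sum (tabulate (machineOpen τ))             ≡⟨ sym (openMachines≡sum-tabulate I τ) ⟩
  openMachines I τ                           ∎
  where open ≤-Reasoning

openMachines-alternating : ∀ r → openMachines (𝓘 (suc (suc r))) (alternating r) ≡ 2
openMachines-alternating r = begin
  openMachines (𝓘 (suc (suc r))) (alternating r)
    ≡⟨ openMachines≡sum-tabulate (𝓘 (suc (suc r))) (alternating r) ⟩
  machineOpen τ zero + (machineOpen τ (suc zero) + sum (tabulate {n = r} (λ k → machineOpen τ (suc (suc k)))))
    ≡⟨ cong₂ _+_ (machineOpen-used τ zero) (cong₂ _+_ (machineOpen-used τ (suc zero)) (sum-tabulate-0 _ unused)) ⟩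
  2 ∎
  where
  open ≡-Reasoning
  τ = alternating r
  unused : ∀ k → machineOpen τ (suc (suc k)) ≡ 0
  unused k = if-⌊⌋-no (any? (λ j → τ j ≟ suc (suc k))) (λ (j , τj≡k) → alternate≢suc-suc (toℕ j) k τj≡k)

firstTwoJobs-separate : ∀ {r} (τ : Schedule (𝓘 (suc (suc r)))) → Feasible (𝓘 (suc (suc r))) τ →
                        τ zero ≢ τ (suc zero)
firstTwoJobs-separate {r} τ feasible τ0≡τ1 = <⇒≱ ≤-refl (≤-trans 3≤completion (feasible (suc zero)))
  where
  open ≤-Reasoning
  loadBefore₁ : Fin (suc (suc r)) → ℕ
  loadBefore₁ k = if (toℕ k ≤ᵇ 1) ∧ ⌊ τ k ≟ τ (suc zero) ⌋ then fibP (toℕ k) else 0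
  3≤completion : 3 ≤ completion (𝓘 (suc (suc r))) τ (suc zero)
  3≤completion = begin
    3                                               ≡⟨ sym (cong₂ _+_ (if-⌊⌋-yes (τ zero ≟ τ (suc zero)) τ0≡τ1)
                                                                      (if-⌊⌋-yes (τ (suc zero) ≟ τ (suc zero)) refl)) ⟩
    loadBefore₁ zero + loadBefore₁ (suc zero)       ≤⟨ +-monoʳ-≤ (loadBefore₁ zero) (m≤m+n _ _) ⟩
    completion (𝓘 (suc (suc r))) τ (suc zero)       ∎

nfGo-neverFits : ∀ (p d : ℕ → ℕ) → (∀ i → d (suc i) < p i + p (suc i)) → ∀ c r →
                 nfGo c (p 0) (applyUpTo (λ i → p (suc i) , d (suc i)) r) ≡ c + r
nfGo-neverFits p d tooLate c zero = sym (+-identityʳ c)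
nfGo-neverFits p d tooLate c (suc r) rewrite ≤ᵇ-false (tooLate 0) =
  trans (nfGo-neverFits (p ∘ suc) (d ∘ suc) (tooLate ∘ suc) (suc c) r) (sym (+-suc c r))

nfList-neverFits : ∀ (p d : ℕ → ℕ) → (∀ i → d (suc i) < p i + p (suc i)) → ∀ n →
                   nfList (applyUpTo (λ i → p i , d i) n) ≡ n
nfList-neverFits p d tooLate zero    = refl
nfList-neverFits p d tooLate (suc r) = nfGo-neverFits p d tooLate 1 r

NF-𝓘 : ∀ n → NF (𝓘 n) ≡ n
NF-𝓘 n = trans (cong nfList (map-allFin-toℕ n (λ i → fibP i , fibD i)))
               (nfList-neverFits fibP fibD tooLate n)
  where
  tooLate : ∀ i → fibD (suc i) < fibP i + fibP (suc i)
  tooLate i = subst (fibD (suc i) <_) (+-comm (fibP (suc i)) (fibP i)) (fibD<fibP-suc (suc i))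

IsOPT-𝓘 : ∀ r → IsOPT (𝓘 (suc (suc r))) 2
IsOPT-𝓘 r = (alternating r , alternating-feasible r , openMachines-alternating r)
          , λ τ feasible → 2≤openMachines (𝓘 (suc (suc r))) τ (firstTwoJobs-separate τ feasible)

lemma1 : (K : ℕ) → Σ ℕ λ n → 2 < n × Σ ℕ λ opt → IsOPT (𝓘 n) opt × K * opt < NF (𝓘 n)
lemma1 K = 3 + K * 2 , s≤s (s≤s (s≤s z≤n)) , 2 , IsOPT-𝓘 (suc (K * 2)) ,
           subst (K * 2 <_) (sym (NF-𝓘 (3 + K * 2))) (m<n+m (K * 2) (s≤s z≤n))
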